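{- Let $H=(h_{ij})_{i,j=1}^{g}$ be a generalized Hadamard matrix $GH(g,1)$ over a finite abelian group of order $g$ with permutation representation $\phi$; for $k\in\{1,\ldots,g\}$ let $C_k=(\phi(-h_{ki}+h_{kj}))_{i,j=1}^{g}$ (order $g^2$), and let $C_0=I_g\otimes J_g$. Then (i) $\sum_{k=0}^gC_k=gI_{g^2}+J_{g^2}$; (ii) $C_kC_k^\top=gC_k$ for every $k\in\{0,1,\ldots,g\}$; (iii) $C_kC_{k'}^\top=J_{g^2}$ for all distinct $k,k'\in\{0,1,\ldots,g\}$.
   Context: $I_n,J_n$ denote the identity and all-ones matrices of order $n$; $\otimes$ is the Kronecker product. A generalized Hadamard matrix $GH(g,\lambda)$ over an additively written abelian group $G$ of order $g$ is a square matrix $H=(h_{ij})$ of order $g\lambda$ with entries in $G$ such that for all distinct rows $i,k$ the multiset $\{h_{ij}-h_{kj}:1\le j\le g\lambda\}$ contains each element of $G$ exactly $\lambda$ times. Write $G\cong\mathbb{Z}_{n_1}\oplus\cdots\oplus\mathbb{Z}_{n_s}$, so $g=n_1\cdots n_s$; let $r_p$ be the $p\times p$ circulant permutation matrix with first row $(0,1,0,\ldots,0)$; the permutation representation is $\phi((x_i)_{i=1}^s)=r_{n_1}^{x_1}\otimes\cdots\otimes r_{n_s}^{x_s}$, a $g\times g$ permutation matrix. -}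

module Defs where

open import Data.Nat using (ℕ; zero; suc; _+_; _*_; _∸_; _%_)
open import Data.Nat.DivMod using (m%n<n)
open import Data.Fin using (Fin; zero; suc; toℕ; fromℕ<; remQuot)
open import Data.Fin.Properties using () renaming (_≟_ to _≟F_)
open import Data.List using (List; []; _∷_)
open import Data.Nat.ListAction using (product)
open import Data.Product using (_×_; _,_; proj₁; proj₂)
open import Data.Unit using (⊤; tt)
open import Relation.Nullary using (yes; no)
open import Relation.Binary.PropositionalEquality using (_≡_; _≢_)

Mat : ℕ → ℕ → Set
Mat m n = Fin m → Fin n → ℕ

Σ[<_]_ : (n : ℕ) → (Fin n → ℕ) → ℕ
Σ[< zero ] f = 0
Σ[< suc n ] f = f zero + Σ[< n ] (λ i → f (suc i))

δ : ∀ {n} → Fin n → Fin n → ℕ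
δ i j with i ≟F j
... | yes _ = 1
... | no _ = 0

Id : (n : ℕ) → Mat n n
Id n = δ

Jm : (n : ℕ) → Mat n n
Jm n _ _ = 1

_ᵀ : ∀ {m n} → Mat m n → Mat n m
(A ᵀ) i j = A j i

_·_ : ∀ {m n p} → Mat m n → Mat n p → Mat m p
_·_ {n = n} A B i j = Σ[< n ] (λ l → A i l * B l j)

_⊕M_ : ∀ {m n} → Mat m n → Mat m n → Mat m n
(A ⊕M B) i j = A i j + B i j

_⊛_ : ∀ {m n} → ℕ → Mat m n → Mat m n
(c ⊛ A) i j = c * A i j

ΣM : ∀ {m n} (k : ℕ) → (Fin k → Mat m n) → Mat m n
ΣM k F i j = Σ[< k ] (λ t → F t i j)

_^M_ : ∀ {n} → Mat n n → ℕ → Mat n n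
_^M_ {n} A zero = Id n
A ^M suc x = A · (A ^M x)

-- Kronecker product; row index of A ⊗ B is (i , i') ↦ i * p + i'
_⊗_ : ∀ {m m' p p'} → Mat m m' → Mat p p' → Mat (m * p) (m' * p')
_⊗_ {m} {m'} {p} {p'} A B I J with remQuot {m} p I | remQuot {m'} p' J
... | (i , i') | (j , j') = A i j * B i' j'

_≈M_ : ∀ {m n} → Mat m n → Mat m n → Set
A ≈M B = ∀ i j → A i j ≡ B i j

-- The group G = Z_{n_1} ⊕ ... ⊕ Z_{n_s}, given by the list of moduli.

addF : ∀ {n} → Fin n → Fin n → Fin n
addF {suc n} a b = fromℕ< (m%n<n (toℕ a + toℕ b) (suc n))

negF : ∀ {n} → Fin n → Fin n
negF {suc n} a = fromℕ< (m%n<n (suc n ∸ toℕ a) (suc n))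

Elt : List ℕ → Set
Elt [] = ⊤
Elt (n ∷ ns) = Fin n × Elt ns

addG : ∀ {ns} → Elt ns → Elt ns → Elt ns
addG {[]} _ _ = tt
addG {n ∷ ns} (a , x) (b , y) = addF a b , addG x y

negG : ∀ {ns} → Elt ns → Elt ns
negG {[]} _ = tt
negG {n ∷ ns} (a , x) = negF a , negG x

subG : ∀ {ns} → Elt ns → Elt ns → Elt ns
subG x y = addG x (negG y)

eqG? : ∀ {ns} → Elt ns → Elt ns → ℕ
eqG? {[]} _ _ = 1
eqG? {n ∷ ns} (a , x) (b , y) with a ≟F b
... | yes _ = eqG? x y
... | no _ = 0

order : List ℕ → ℕ
order ns = product ns

r : (p : ℕ) → Mat p p
r zero ()
r (suc p) i j with toℕ j Data.Nat.≟ ((toℕ i + 1) % suc p)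
... | yes _ = 1
... | no _ = 0

φ : ∀ ns → Elt ns → Mat (order ns) (order ns)
φ [] _ = Id 1
φ (n ∷ ns) (x , xs) = (r n ^M toℕ x) ⊗ φ ns xs

IsGH : ∀ ns (λ' : ℕ) {N : ℕ} → (Fin N → Fin N → Elt ns) → Set
IsGH ns λ' {N} H = (N ≡ order ns * λ') ×
  (∀ i k → i ≢ k → ∀ (a : Elt ns) →
     Σ[< N ] (λ j → eqG? (subG (H i j) (H k j)) a) ≡ λ')

-- the matrices C_k, k ∈ {0,…,g} (k = 0 ↦ zero, k ≥ 1 ↦ suc (k-1))

Cmat : ∀ ns → (Fin (order ns) → Fin (order ns) → Elt ns) →
       Fin (suc (order ns)) → Mat (order ns * order ns) (order ns * order ns)
Cmat ns H zero = Id (order ns) ⊗ Jm (order ns)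
Cmat ns H (suc k) I J with remQuot {order ns} (order ns) I | remQuot {order ns} (order ns) J
... | (i , i') | (j , j') = φ ns (addG (negG (H k i)) (H k j)) i' j'

-- Index the rows and columns of C_k by pairs (i , u) of a block i and a position u, and label
-- them by elements of G: for C_0 the label is i, for C_k (k ≥ 1) it is u − h_ki.  Then
-- φ(−h_ki + h_kj) has entry 1 at (u , v) exactly when u − h_ki = v − h_kj, so every C_k is the
-- "same label" matrix of its labelling.  Each label class has g members, whence C_k C_kᵀ = g C_k.
-- Classes of two different labellings meet in exactly one index: for C_0 against C_k because
-- u ↦ u − h_ki is a bijection, for C_k against C_k′ because h_kl − h_k′l takes every value once.
-- For (i), two indices of the same block agree in every labelling iff they are equal, while
-- indices in blocks i ≠ j agree in exactly one labelling, because the column differences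
-- h_kj − h_ki are pairwise distinct (a repetition would make a row difference repeat) and hence,
-- by counting, take every value of G exactly once.
module Submission where

open import Defs

open import Algebra.Properties.CommutativeSemigroup using (interchange)
open import Data.Bool.Base using (if_then_else_)
open import Data.Empty using (⊥-elim)
open import Data.Fin using (Fin; zero; suc; toℕ; fromℕ<; remQuot; combine; _↑ˡ_; _↑ʳ_; punchOut)
open import Data.Fin.Properties
  using (toℕ-injective; toℕ-fromℕ<; toℕ<n; remQuot-combine; combine-remQuot; any?; punchOut-injective; injective⇒≤)
  renaming (_≟_ to _≟F_)
open import Data.List using (List; []; _∷_)
open import Data.Nat using (ℕ; zero; suc; _+_; _*_; _∸_; _%_; _≤_; z≤n; s≤s; NonZero) renaming (_≟_ to _≟ℕ_)
open import Data.Nat.DivMod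
open import Data.Nat.Properties
open import Data.Product using (_×_; _,_; proj₁; proj₂; uncurry; ∃)
open import Data.Product.Properties using (,-injective)
open import Data.Unit using (tt)
open import Function using (_∘_)
open import Function.Bundles using (_⇔_; mk⇔; Equivalence)
open import Function.Definitions using (Injective)
open import Function.Properties.Equivalence using (⇔-setoid; ⇔-isEquivalence)
open import Level using (0ℓ)
open import Relation.Binary.Definitions using (DecidableEquality)
open import Relation.Binary.PropositionalEquality
import Relation.Binary.Reasoning.Setoid
open import Relation.Binary.Structures using (IsEquivalence)
open import Relation.Nullary using (Dec; yes; no; does; ¬_; map′; _×-dec_)
open import Relation.Unary using (Pred; Decidable)

≡-sym-⇔ : ∀ {a} {A : Set a} {x y : A} → x ≡ y ⇔ y ≡ x
≡-sym-⇔ = mk⇔ sym sym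

⇔-trans : ∀ {A B C : Set} → A ⇔ B → B ⇔ C → A ⇔ C
⇔-trans = IsEquivalence.trans ⇔-isEquivalence

⇔-sym : ∀ {A B : Set} → A ⇔ B → B ⇔ A
⇔-sym = IsEquivalence.sym ⇔-isEquivalence

module ⇔-Reasoning = Relation.Binary.Reasoning.Setoid (⇔-setoid 0ℓ)

𝟙 : ∀ {a} {A : Set a} → Dec A → ℕ
𝟙 a? = if does a? then 1 else 0

𝟙-cong : ∀ {a b} {A : Set a} {B : Set b} → A ⇔ B → (a? : Dec A) (b? : Dec B) → 𝟙 a? ≡ 𝟙 b?
𝟙-cong A⇔B (yes a) (yes b) = refl
𝟙-cong A⇔B (yes a) (no ¬b) = ⊥-elim (¬b (Equivalence.to A⇔B a))
𝟙-cong A⇔B (no ¬a) (yes b) = ⊥-elim (¬a (Equivalence.from A⇔B b))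
𝟙-cong A⇔B (no ¬a) (no ¬b) = refl

𝟙≟-cong : ∀ {a b} {A : Set a} {B : Set b} (_≟A_ : DecidableEquality A) (_≟B_ : DecidableEquality B)
          {x y : A} {x′ y′ : B} → x ≡ y ⇔ x′ ≡ y′ → 𝟙 (x ≟A y) ≡ 𝟙 (x′ ≟B y′)
𝟙≟-cong _≟A_ _≟B_ {x} {y} {x′} {y′} e = 𝟙-cong e (x ≟A y) (x′ ≟B y′)

𝟙-yes : ∀ {a} {A : Set a} → A → (a? : Dec A) → 𝟙 a? ≡ 1
𝟙-yes _ (yes _) = refl
𝟙-yes a (no ¬a) = ⊥-elim (¬a a)

𝟙-×-dec : ∀ {a b} {A : Set a} {B : Set b} (a? : Dec A) (b? : Dec B) → 𝟙 (a? ×-dec b?) ≡ 𝟙 a? * 𝟙 b?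
𝟙-×-dec (yes _) b? = sym (+-identityʳ (𝟙 b?))
𝟙-×-dec (no _)  b? = refl

δ-𝟙 : ∀ {n} (i j : Fin n) → δ i j ≡ 𝟙 (i ≟F j)
δ-𝟙 i j with i ≟F j
... | yes _ = refl
... | no _  = refl

Σ-cong : ∀ n {f h : Fin n → ℕ} → (∀ i → f i ≡ h i) → Σ[< n ] f ≡ Σ[< n ] h
Σ-cong zero    f≗h = refl
Σ-cong (suc n) f≗h = cong₂ _+_ (f≗h zero) (Σ-cong n (λ i → f≗h (suc i)))

Σ-const : ∀ n c → Σ[< n ] (λ _ → c) ≡ n * c
Σ-const zero    c = refl
Σ-const (suc n) c = cong (c +_) (Σ-const n c)

Σ-*ˡ : ∀ n c (f : Fin n → ℕ) → Σ[< n ] (λ i → c * f i) ≡ c * Σ[< n ] f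
Σ-*ˡ zero    c f = sym (*-zeroʳ c)
Σ-*ˡ (suc n) c f = trans (cong (c * f zero +_) (Σ-*ˡ n c (λ i → f (suc i))))
                         (sym (*-distribˡ-+ c (f zero) _))

Σ-+ : ∀ n (f h : Fin n → ℕ) → Σ[< n ] (λ i → f i + h i) ≡ Σ[< n ] f + Σ[< n ] h
Σ-+ zero    f h = refl
Σ-+ (suc n) f h = trans (cong (f zero + h zero +_) (Σ-+ n (λ i → f (suc i)) (λ i → h (suc i))))
                        (interchange +-commutativeSemigroup (f zero) (h zero) _ _)

Σ-mono : ∀ n {f h : Fin n → ℕ} → (∀ i → f i ≤ h i) → Σ[< n ] f ≤ Σ[< n ] h
Σ-mono zero    f≤h = z≤n
Σ-mono (suc n) f≤h = +-mono-≤ (f≤h zero) (Σ-mono n (λ i → f≤h (suc i)))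

Σ-++ : ∀ m n (f : Fin (m + n) → ℕ) →
       Σ[< m + n ] f ≡ Σ[< m ] (λ i → f (i ↑ˡ n)) + Σ[< n ] (λ j → f (m ↑ʳ j))
Σ-++ zero    n f = refl
Σ-++ (suc m) n f = trans (cong (f zero +_) (Σ-++ m n (λ i → f (suc i)))) (sym (+-assoc (f zero) _ _))

Σ-combine : ∀ m n (f : Fin (m * n) → ℕ) →
            Σ[< m * n ] f ≡ Σ[< m ] (λ i → Σ[< n ] (λ j → f (combine i j)))
Σ-combine zero    n f = refl
Σ-combine (suc m) n f = trans (Σ-++ n (m * n) f)
  (cong (Σ[< n ] (λ j → f (j ↑ˡ m * n)) +_) (Σ-combine m n (λ k → f (n ↑ʳ k))))

Σ-point : ∀ n (e : Fin n) (f : Fin n → ℕ) → Σ[< n ] (λ w → 𝟙 (w ≟F e) * f w) ≡ f e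
Σ-point (suc n) zero    f = trans (cong₂ _+_ (*-identityˡ (f zero)) (trans (Σ-const n 0) (*-zeroʳ n)))
                                  (+-identityʳ (f zero))
Σ-point (suc n) (suc e) f = Σ-point n e (λ i → f (suc i))

Σ-unique : ∀ {p} n {P : Pred (Fin n) p} (P? : Decidable P) {e : Fin n} → (∀ w → P w ⇔ w ≡ e) →
           (f : Fin n → ℕ) → Σ[< n ] (λ w → 𝟙 (P? w) * f w) ≡ f e
Σ-unique n P? {e} P⇔≡e f =
  trans (Σ-cong n (λ w → cong (_* f w) (𝟙-cong (P⇔≡e w) (P? w) (w ≟F e)))) (Σ-point n e f)

Σ-unique-𝟙 : ∀ {p} n {P : Pred (Fin n) p} (P? : Decidable P) {e : Fin n} → (∀ w → P w ⇔ w ≡ e) →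
             Σ[< n ] (λ w → 𝟙 (P? w)) ≡ 1
Σ-unique-𝟙 n P? P⇔≡e =
  trans (Σ-cong n (λ w → sym (*-identityʳ (𝟙 (P? w))))) (Σ-unique n P? P⇔≡e (λ _ → 1))

Σ-two : ∀ n (f : Fin n → ℕ) {i j : Fin n} → i ≢ j → f i + f j ≤ Σ[< n ] f
Σ-two n f {i} {j} i≢j = begin
  f i + f j                                                      ≡⟨ cong₂ _+_ (Σ-point n i f) (Σ-point n j f) ⟨
  Σ[< n ] (λ w → 𝟙 (w ≟F i) * f w) + Σ[< n ] (λ w → 𝟙 (w ≟F j) * f w)  ≡⟨ Σ-+ n _ _ ⟨
  Σ[< n ] (λ w → 𝟙 (w ≟F i) * f w + 𝟙 (w ≟F j) * f w)            ≤⟨ Σ-mono n at-most-once ⟩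
  Σ[< n ] f                                                      ∎
  where
  open ≤-Reasoning
  at-most-once : ∀ w → 𝟙 (w ≟F i) * f w + 𝟙 (w ≟F j) * f w ≤ f w
  at-most-once w with w ≟F i | w ≟F j
  ... | yes refl | yes refl = ⊥-elim (i≢j refl)
  ... | yes _    | no _     = ≤-reflexive (trans (+-identityʳ (f w + 0)) (+-identityʳ (f w)))
  ... | no _     | yes _    = ≤-reflexive (+-identityʳ (f w))
  ... | no _     | no _     = z≤n

injective⇒surjective : ∀ {n} {h : Fin n → Fin n} → Injective _≡_ _≡_ h → ∀ b → ∃ λ a → h a ≡ b
injective⇒surjective {n} {h} h-inj b with any? (λ a → h a ≟F b)
... | yes hit = hit
injective⇒surjective {suc m} {h} h-inj b | no miss = ⊥-elim (<-irrefl refl (injective⇒≤ h′-inj))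
  where
  h′ : Fin (suc m) → Fin m
  h′ a = punchOut {i = b} {j = h a} (λ e → miss (a , sym e))
  h′-inj : Injective _≡_ _≡_ h′
  h′-inj {a} {a′} e = h-inj (punchOut-injective (λ e′ → miss (a , sym e′)) (λ e′ → miss (a′ , sym e′)) e)

≡⇔remQuot≡remQuot : ∀ {m} n (I J : Fin (m * n)) → I ≡ J ⇔ remQuot {m} n I ≡ remQuot {m} n J
≡⇔remQuot≡remQuot {m} n I J = mk⇔ (cong (remQuot n))
  (λ e → trans (sym (combine-remQuot {m} n I)) (trans (cong (uncurry combine) e) (combine-remQuot {m} n J)))

[m%n+k]%n≡[m+k]%n : ∀ m k n .{{_ : NonZero n}} → (m % n + k) % n ≡ (m + k) % n
[m%n+k]%n≡[m+k]%n m k n = begin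
  (m % n + k) % n         ≡⟨ %-distribˡ-+ (m % n) k n ⟩
  (m % n % n + k % n) % n ≡⟨ cong (λ z → (z + k % n) % n) (m%n%n≡m%n m n) ⟩
  (m % n + k % n) % n     ≡⟨ %-distribˡ-+ m k n ⟨
  (m + k) % n             ∎
  where open ≡-Reasoning

toℕ-addF : ∀ {p} (a b : Fin (suc p)) → toℕ (addF a b) ≡ (toℕ a + toℕ b) % suc p
toℕ-addF {p} a b = toℕ-fromℕ< (m%n<n (toℕ a + toℕ b) (suc p))

toℕ-negF : ∀ {p} (a : Fin (suc p)) → toℕ (negF a) ≡ (suc p ∸ toℕ a) % suc p
toℕ-negF {p} a = toℕ-fromℕ< (m%n<n (suc p ∸ toℕ a) (suc p))

addF-comm : ∀ {n} (a b : Fin n) → addF a b ≡ addF b a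
addF-comm {suc p} a b = toℕ-injective (begin
  toℕ (addF a b)             ≡⟨ toℕ-addF a b ⟩
  (toℕ a + toℕ b) % suc p    ≡⟨ cong (_% suc p) (+-comm (toℕ a) (toℕ b)) ⟩
  (toℕ b + toℕ a) % suc p    ≡⟨ toℕ-addF b a ⟨
  toℕ (addF b a)             ∎)
  where open ≡-Reasoning

addF-assoc : ∀ {n} (a b c : Fin n) → addF (addF a b) c ≡ addF a (addF b c)
addF-assoc {suc p} a b c = toℕ-injective (begin
  toℕ (addF (addF a b) c)                   ≡⟨ toℕ-addF (addF a b) c ⟩
  (toℕ (addF a b) + toℕ c) % suc p          ≡⟨ cong (λ z → (z + toℕ c) % suc p) (toℕ-addF a b) ⟩
  ((toℕ a + toℕ b) % suc p + toℕ c) % suc p ≡⟨ [m%n+k]%n≡[m+k]%n (toℕ a + toℕ b) (toℕ c) (suc p) ⟩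
  (toℕ a + toℕ b + toℕ c) % suc p           ≡⟨ cong (_% suc p) (trans (+-assoc (toℕ a) _ _) (+-comm (toℕ a) _)) ⟩
  (toℕ b + toℕ c + toℕ a) % suc p           ≡⟨ [m%n+k]%n≡[m+k]%n (toℕ b + toℕ c) (toℕ a) (suc p) ⟨
  ((toℕ b + toℕ c) % suc p + toℕ a) % suc p ≡⟨ cong (λ z → (z + toℕ a) % suc p) (toℕ-addF b c) ⟨
  (toℕ (addF b c) + toℕ a) % suc p          ≡⟨ cong (_% suc p) (+-comm (toℕ (addF b c)) (toℕ a)) ⟩
  (toℕ a + toℕ (addF b c)) % suc p          ≡⟨ toℕ-addF a (addF b c) ⟨
  toℕ (addF a (addF b c))                   ∎)
  where open ≡-Reasoning

addF-addF-negF : ∀ {n} (x a : Fin n) → addF (addF x a) (negF a) ≡ x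
addF-addF-negF {suc p} x a = toℕ-injective (begin
  toℕ (addF (addF x a) (negF a))                        ≡⟨ toℕ-addF (addF x a) (negF a) ⟩
  (toℕ (addF x a) + toℕ (negF a)) % suc p               ≡⟨ cong₂ (λ y z → (y + z) % suc p) (toℕ-addF x a) (toℕ-negF a) ⟩
  ((toℕ x + toℕ a) % suc p + (suc p ∸ toℕ a) % suc p) % suc p ≡⟨ %-distribˡ-+ (toℕ x + toℕ a) _ (suc p) ⟨
  (toℕ x + toℕ a + (suc p ∸ toℕ a)) % suc p             ≡⟨ cong (_% suc p) (+-assoc (toℕ x) (toℕ a) _) ⟩
  (toℕ x + (toℕ a + (suc p ∸ toℕ a))) % suc p           ≡⟨ cong (λ z → (toℕ x + z) % suc p) (m+[n∸m]≡n (<⇒≤ (toℕ<n a))) ⟩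
  (toℕ x + suc p) % suc p                               ≡⟨ [m+n]%n≡m%n (toℕ x) (suc p) ⟩
  toℕ x % suc p                                         ≡⟨ m<n⇒m%n≡m (toℕ<n x) ⟩
  toℕ x                                                 ∎)
  where open ≡-Reasoning

rotate : ∀ {n} → ℕ → Fin n → Fin n
rotate {suc p} t a = fromℕ< (m%n<n (toℕ a + t) (suc p))

rotate-zero : ∀ {p} (a : Fin (suc p)) → rotate 0 a ≡ a
rotate-zero {p} a = toℕ-injective (begin
  toℕ (rotate 0 a)       ≡⟨ toℕ-fromℕ< (m%n<n (toℕ a + 0) (suc p)) ⟩
  (toℕ a + 0) % suc p    ≡⟨ cong (_% suc p) (+-identityʳ (toℕ a)) ⟩
  toℕ a % suc p          ≡⟨ m<n⇒m%n≡m (toℕ<n a) ⟩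
  toℕ a                  ∎)
  where open ≡-Reasoning

rotate-suc : ∀ {p} t (a : Fin (suc p)) → rotate t (rotate 1 a) ≡ rotate (suc t) a
rotate-suc {p} t a = toℕ-injective (begin
  toℕ (rotate t (rotate 1 a))            ≡⟨ toℕ-fromℕ< (m%n<n (toℕ (rotate 1 a) + t) (suc p)) ⟩
  (toℕ (rotate 1 a) + t) % suc p         ≡⟨ cong (λ z → (z + t) % suc p) (toℕ-fromℕ< (m%n<n (toℕ a + 1) (suc p))) ⟩
  ((toℕ a + 1) % suc p + t) % suc p      ≡⟨ [m%n+k]%n≡[m+k]%n (toℕ a + 1) t (suc p) ⟩
  (toℕ a + 1 + t) % suc p                ≡⟨ cong (_% suc p) (+-assoc (toℕ a) 1 t) ⟩
  (toℕ a + suc t) % suc p                ≡⟨ toℕ-fromℕ< (m%n<n (toℕ a + suc t) (suc p)) ⟨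
  toℕ (rotate (suc t) a)                 ∎)
  where open ≡-Reasoning

infixl 6 _+ᴳ_ _-ᴳ_
_+ᴳ_ : ∀ {ns} → Elt ns → Elt ns → Elt ns
_+ᴳ_ = addG

_-ᴳ_ : ∀ {ns} → Elt ns → Elt ns → Elt ns
_-ᴳ_ = subG

+ᴳ-comm : ∀ {ns} (x y : Elt ns) → x +ᴳ y ≡ y +ᴳ x
+ᴳ-comm {[]}     _       _       = refl
+ᴳ-comm {n ∷ ns} (a , x) (b , y) = cong₂ _,_ (addF-comm a b) (+ᴳ-comm x y)

+ᴳ-assoc : ∀ {ns} (x y z : Elt ns) → x +ᴳ y +ᴳ z ≡ x +ᴳ (y +ᴳ z)
+ᴳ-assoc {[]}     _       _       _       = refl
+ᴳ-assoc {n ∷ ns} (a , x) (b , y) (c , z) = cong₂ _,_ (addF-assoc a b c) (+ᴳ-assoc x y z)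

x+a-a≡x : ∀ {ns} (x a : Elt ns) → x +ᴳ a -ᴳ a ≡ x
x+a-a≡x {[]}     _       _       = refl
x+a-a≡x {n ∷ ns} (x , xs) (a , as) = cong₂ _,_ (addF-addF-negF x a) (x+a-a≡x xs as)

x-a+b≡x+b-a : ∀ {ns} (x a b : Elt ns) → x -ᴳ a +ᴳ b ≡ x +ᴳ b -ᴳ a
x-a+b≡x+b-a x a b = begin
  x -ᴳ a +ᴳ b          ≡⟨ +ᴳ-assoc x (negG a) b ⟩
  x +ᴳ (negG a +ᴳ b)   ≡⟨ cong (x +ᴳ_) (+ᴳ-comm (negG a) b) ⟩
  x +ᴳ (b +ᴳ negG a)   ≡⟨ +ᴳ-assoc x b (negG a) ⟨
  x +ᴳ b -ᴳ a          ∎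
  where open ≡-Reasoning

x-a+a≡x : ∀ {ns} (x a : Elt ns) → x -ᴳ a +ᴳ a ≡ x
x-a+a≡x x a = trans (x-a+b≡x+b-a x a a) (x+a-a≡x x a)

module _ {ns : List ℕ} where

  x-a≡c⇔x≡c+a : (x a c : Elt ns) → x -ᴳ a ≡ c ⇔ x ≡ c +ᴳ a
  x-a≡c⇔x≡c+a x a c = mk⇔ (λ e → trans (sym (x-a+a≡x x a)) (cong (_+ᴳ a) e))
                          (λ e → trans (cong (_-ᴳ a) e) (x+a-a≡x c a))

  x-a≡y-b⇔x+b≡y+a : (x a y b : Elt ns) → x -ᴳ a ≡ y -ᴳ b ⇔ x +ᴳ b ≡ y +ᴳ a
  x-a≡y-b⇔x+b≡y+a x a y b = begin
    x -ᴳ a ≡ y -ᴳ b   ≈⟨ x-a≡c⇔x≡c+a x a (y -ᴳ b) ⟩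
    x ≡ y -ᴳ b +ᴳ a   ≡⟨ cong (x ≡_) (x-a+b≡x+b-a y b a) ⟩
    x ≡ y +ᴳ a -ᴳ b   ≈⟨ ≡-sym-⇔ ⟩
    y +ᴳ a -ᴳ b ≡ x   ≈⟨ x-a≡c⇔x≡c+a (y +ᴳ a) b x ⟩
    y +ᴳ a ≡ x +ᴳ b   ≈⟨ ≡-sym-⇔ ⟩
    x +ᴳ b ≡ y +ᴳ a   ∎
    where open ⇔-Reasoning

  x-a≡y-a⇔x≡y : (x y a : Elt ns) → x -ᴳ a ≡ y -ᴳ a ⇔ x ≡ y
  x-a≡y-a⇔x≡y x y a = mk⇔ (λ e → trans (sym (x-a+a≡x x a)) (trans (cong (_+ᴳ a) e) (x-a+a≡x y a)))
                          (cong (_-ᴳ a))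

  v≡u+[-a+b]⇔u-a≡v-b : (u v a b : Elt ns) → v ≡ u +ᴳ (negG a +ᴳ b) ⇔ u -ᴳ a ≡ v -ᴳ b
  v≡u+[-a+b]⇔u-a≡v-b u v a b = begin
    v ≡ u +ᴳ (negG a +ᴳ b)   ≡⟨ cong (v ≡_) (+ᴳ-assoc u (negG a) b) ⟨
    v ≡ u -ᴳ a +ᴳ b          ≈⟨ x-a≡c⇔x≡c+a v b (u -ᴳ a) ⟨
    v -ᴳ b ≡ u -ᴳ a          ≈⟨ ≡-sym-⇔ ⟩
    u -ᴳ a ≡ v -ᴳ b          ∎
    where open ⇔-Reasoning

  c′≡c+a-b⇔a-b≡c′-c : (c c′ a b : Elt ns) → c′ ≡ c +ᴳ a -ᴳ b ⇔ a -ᴳ b ≡ c′ -ᴳ c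
  c′≡c+a-b⇔a-b≡c′-c c c′ a b = begin
    c′ ≡ c +ᴳ a -ᴳ b       ≡⟨ cong (c′ ≡_) (trans (+ᴳ-assoc c a (negG b)) (+ᴳ-comm c (a -ᴳ b))) ⟩
    c′ ≡ a -ᴳ b +ᴳ c       ≈⟨ x-a≡c⇔x≡c+a c′ c (a -ᴳ b) ⟨
    c′ -ᴳ c ≡ a -ᴳ b       ≈⟨ ≡-sym-⇔ ⟩
    a -ᴳ b ≡ c′ -ᴳ c       ∎
    where open ⇔-Reasoning

  u-a≡v-b⇔b-a≡v-u : (u a v b : Elt ns) → u -ᴳ a ≡ v -ᴳ b ⇔ b -ᴳ a ≡ v -ᴳ u
  u-a≡v-b⇔b-a≡v-u u a v b = begin
    u -ᴳ a ≡ v -ᴳ b   ≈⟨ x-a≡y-b⇔x+b≡y+a u a v b ⟩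
    u +ᴳ b ≡ v +ᴳ a   ≡⟨ cong (_≡ v +ᴳ a) (+ᴳ-comm u b) ⟩
    b +ᴳ u ≡ v +ᴳ a   ≈⟨ x-a≡y-b⇔x+b≡y+a b a v u ⟨
    b -ᴳ a ≡ v -ᴳ u   ∎
    where open ⇔-Reasoning

  b-a≡b′-a′⇔b-b′≡a-a′ : (b a b′ a′ : Elt ns) → b -ᴳ a ≡ b′ -ᴳ a′ ⇔ b -ᴳ b′ ≡ a -ᴳ a′
  b-a≡b′-a′⇔b-b′≡a-a′ b a b′ a′ = begin
    b -ᴳ a ≡ b′ -ᴳ a′   ≈⟨ x-a≡y-b⇔x+b≡y+a b a b′ a′ ⟩
    b +ᴳ a′ ≡ b′ +ᴳ a   ≡⟨ cong (b +ᴳ a′ ≡_) (+ᴳ-comm b′ a) ⟩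
    b +ᴳ a′ ≡ a +ᴳ b′   ≈⟨ x-a≡y-b⇔x+b≡y+a b b′ a a′ ⟨
    b -ᴳ b′ ≡ a -ᴳ a′   ∎
    where open ⇔-Reasoning

infix 4 _≟G_
_≟G_ : ∀ {ns} (x y : Elt ns) → Dec (x ≡ y)
_≟G_ {[]}     _       _       = yes refl
_≟G_ {n ∷ ns} (a , x) (b , y) = map′ (uncurry (cong₂ _,_)) ,-injective (a ≟F b ×-dec x ≟G y)

eqG?-𝟙 : ∀ {ns} (x y : Elt ns) → eqG? x y ≡ 𝟙 (x ≟G y)
eqG?-𝟙 {[]}     _       _       = refl
eqG?-𝟙 {n ∷ ns} (a , x) (b , y) with a ≟F b
... | yes _ = eqG?-𝟙 x y
... | no _  = refl

-- Decodes indices in the mixed-radix order used by _⊗_ in φ.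
element : ∀ ns → Fin (order ns) → Elt ns
element []       _ = tt
element (n ∷ ns) I = proj₁ (remQuot {n} (order ns) I) , element ns (proj₂ (remQuot {n} (order ns) I))

index : ∀ ns → Elt ns → Fin (order ns)
index []       _       = zero
index (n ∷ ns) (a , x) = combine a (index ns x)

element-index : ∀ ns (x : Elt ns) → element ns (index ns x) ≡ x
element-index []       _       = refl
element-index (n ∷ ns) (a , x) =
  cong₂ _,_ (cong proj₁ split) (trans (cong (element ns ∘ proj₂) split) (element-index ns x))
  where split = remQuot-combine {n} {order ns} a (index ns x)

index-element : ∀ ns (I : Fin (order ns)) → index ns (element ns I) ≡ I
index-element []       zero = refl
index-element (n ∷ ns) I =
  trans (cong (combine (proj₁ (remQuot {n} (order ns) I))) (index-element ns (proj₂ (remQuot {n} (order ns) I))))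
        (combine-remQuot {n} (order ns) I)

index-injective : ∀ ns {x y : Elt ns} → index ns x ≡ index ns y → x ≡ y
index-injective ns {x} {y} e = trans (sym (element-index ns x)) (trans (cong (element ns) e) (element-index ns y))

element≡⇔≡index : ∀ ns (I : Fin (order ns)) (x : Elt ns) → element ns I ≡ x ⇔ I ≡ index ns x
element≡⇔≡index ns I x = mk⇔ (λ e → trans (sym (index-element ns I)) (cong (index ns) e))
                            (λ e → trans (cong (element ns) e) (element-index ns x))

≡⇔element≡element : ∀ ns (i j : Fin (order ns)) → i ≡ j ⇔ element ns i ≡ element ns j
≡⇔element≡element ns i j = mk⇔ (cong (element ns))
  (λ e → trans (sym (index-element ns i)) (trans (cong (index ns) e) (index-element ns j)))

≡element-a⇔≡index : ∀ ns (w : Fin (order ns)) (c a : Elt ns) → c ≡ element ns w -ᴳ a ⇔ w ≡ index ns (c +ᴳ a)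
≡element-a⇔≡index ns w c a = begin
  c ≡ element ns w -ᴳ a     ≈⟨ ≡-sym-⇔ ⟩
  element ns w -ᴳ a ≡ c     ≈⟨ x-a≡c⇔x≡c+a (element ns w) a c ⟩
  element ns w ≡ c +ᴳ a     ≈⟨ element≡⇔≡index ns w (c +ᴳ a) ⟩
  w ≡ index ns (c +ᴳ a)     ∎
  where open ⇔-Reasoning

r-entry : ∀ {p} (a c : Fin (suc p)) → r (suc p) a c ≡ 𝟙 (c ≟F rotate 1 a)
r-entry {p} a c with toℕ c ≟ℕ (toℕ a + 1) % suc p | c ≟F rotate 1 a
... | yes _  | yes _  = refl
... | no _   | no _   = refl
... | yes e  | no c≢  = ⊥-elim (c≢ (toℕ-injective (trans e (sym (toℕ-fromℕ< (m%n<n (toℕ a + 1) (suc p)))))))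
... | no ne  | yes e  = ⊥-elim (ne (trans (cong toℕ e) (toℕ-fromℕ< (m%n<n (toℕ a + 1) (suc p)))))

r^-entry : ∀ {p} t (a b : Fin (suc p)) → (r (suc p) ^M t) a b ≡ 𝟙 (b ≟F rotate t a)
r^-entry zero    a b = trans (δ-𝟙 a b) (𝟙≟-cong _≟F_ _≟F_ (mk⇔ (λ e → trans (sym e) (sym (rotate-zero a)))
                                                             (λ e → sym (trans e (rotate-zero a)))))
r^-entry {p} (suc t) a b = begin
  Σ[< suc p ] (λ c → r (suc p) a c * (r (suc p) ^M t) c b)        ≡⟨ Σ-cong (suc p) (λ c → cong₂ _*_ (r-entry a c) (r^-entry t c b)) ⟩
  Σ[< suc p ] (λ c → 𝟙 (c ≟F rotate 1 a) * 𝟙 (b ≟F rotate t c))  ≡⟨ Σ-point (suc p) (rotate 1 a) (λ c → 𝟙 (b ≟F rotate t c)) ⟩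
  𝟙 (b ≟F rotate t (rotate 1 a))                                  ≡⟨ cong (λ c → 𝟙 (b ≟F c)) (rotate-suc t a) ⟩
  𝟙 (b ≟F rotate (suc t) a)                                       ∎
  where open ≡-Reasoning

φ-entry : ∀ ns (x : Elt ns) (I J : Fin (order ns)) → φ ns x I J ≡ 𝟙 (element ns J ≟G element ns I +ᴳ x)
φ-entry []            _        zero zero = refl
φ-entry (suc p ∷ ns) (x , xs) I J =
  trans (cong₂ _*_ (r^-entry (toℕ x) i j) (φ-entry ns xs I′ J′))
        (sym (𝟙-×-dec (j ≟F addF i x) (element ns J′ ≟G element ns I′ +ᴳ xs)))
  where
  i = proj₁ (remQuot {suc p} (order ns) I)
  j = proj₁ (remQuot {suc p} (order ns) J)
  I′ = proj₂ (remQuot {suc p} (order ns) I)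
  J′ = proj₂ (remQuot {suc p} (order ns) J)

module SameLabel {a} {A : Set a} (_≟A_ : DecidableEquality A) {N : ℕ} where

  meet : (L L′ : Fin N → A) → A → A → ℕ
  meet L L′ c c′ = Σ[< N ] (λ Z → 𝟙 (c ≟A L Z) * 𝟙 (c′ ≟A L′ Z))

  meet-comm : ∀ L L′ c c′ → meet L L′ c c′ ≡ meet L′ L c′ c
  meet-comm L L′ c c′ = Σ-cong N (λ Z → *-comm (𝟙 (c ≟A L Z)) (𝟙 (c′ ≟A L′ Z)))

  meet-self : ∀ L c c′ → meet L L c c′ ≡ 𝟙 (c ≟A c′) * Σ[< N ] (λ Z → 𝟙 (c ≟A L Z))
  meet-self L c c′ = trans (Σ-cong N both) (Σ-*ˡ N (𝟙 (c ≟A c′)) (λ Z → 𝟙 (c ≟A L Z)))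
    where
    both : ∀ Z → 𝟙 (c ≟A L Z) * 𝟙 (c′ ≟A L Z) ≡ 𝟙 (c ≟A c′) * 𝟙 (c ≟A L Z)
    both Z with c ≟A L Z | c′ ≟A L Z | c ≟A c′
    ... | yes _    | yes _    | yes _   = refl
    ... | yes refl | yes refl | no c≢c′ = ⊥-elim (c≢c′ refl)
    ... | yes refl | no c′≢   | yes refl = ⊥-elim (c′≢ refl)
    ... | yes _    | no _     | no _    = refl
    ... | no _     | _        | yes _   = refl
    ... | no _     | _        | no _    = refl

  module _ {C C′ : Mat N N} {L L′ : Fin N → A}
           (C≡ : ∀ I J → C I J ≡ 𝟙 (L I ≟A L J)) (C′≡ : ∀ I J → C′ I J ≡ 𝟙 (L′ I ≟A L′ J)) where

    ·ᵀ-meet : ∀ I J → (C · (C′ ᵀ)) I J ≡ meet L L′ (L I) (L′ J)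
    ·ᵀ-meet I J = Σ-cong N (λ Z → cong₂ _*_ (C≡ I Z) (C′≡ J Z))

    ·ᵀ-transversal : (∀ c c′ → meet L L′ c c′ ≡ 1) → ∀ I J → (C · (C′ ᵀ)) I J ≡ 1
    ·ᵀ-transversal once I J = trans (·ᵀ-meet I J) (once (L I) (L′ J))

  ·ᵀ-self : ∀ {C : Mat N N} {L : Fin N → A} {s} → (∀ I J → C I J ≡ 𝟙 (L I ≟A L J)) →
            (∀ c → Σ[< N ] (λ Z → 𝟙 (c ≟A L Z)) ≡ s) → ∀ I J → (C · (C ᵀ)) I J ≡ s * C I J
  ·ᵀ-self {C} {L} {s} C≡ size I J = begin
    (C · (C ᵀ)) I J                                          ≡⟨ ·ᵀ-meet C≡ C≡ I J ⟩
    meet L L (L I) (L J)                                     ≡⟨ meet-self L (L I) (L J) ⟩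
    𝟙 (L I ≟A L J) * Σ[< N ] (λ Z → 𝟙 (L I ≟A L Z))         ≡⟨ cong (𝟙 (L I ≟A L J) *_) (size (L I)) ⟩
    𝟙 (L I ≟A L J) * s                                       ≡⟨ *-comm _ s ⟩
    s * 𝟙 (L I ≟A L J)                                       ≡⟨ cong (s *_) (C≡ I J) ⟨
    s * C I J                                                ∎
    where open ≡-Reasoning

module Net (ns : List ℕ) (H : Fin (order ns) → Fin (order ns) → Elt ns) where

  open SameLabel (_≟G_ {ns})

  g : ℕ
  g = order ns

  label′ : Fin (suc g) → Fin g × Fin g → Elt ns
  label′ zero    (i , u) = element ns i
  label′ (suc k) (i , u) = element ns u -ᴳ H k i

  label : Fin (suc g) → Fin (g * g) → Elt ns
  label k I = label′ k (remQuot g I)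

  Cmat-label : ∀ k I J → Cmat ns H k I J ≡ 𝟙 (label k I ≟G label k J)
  Cmat-label zero    I J =
    trans (*-identityʳ (δ i j)) (trans (δ-𝟙 i j) (𝟙≟-cong _≟F_ _≟G_ (≡⇔element≡element ns i j)))
    where i = proj₁ (remQuot {g} g I); j = proj₁ (remQuot {g} g J)
  Cmat-label (suc k) I J =
    trans (φ-entry ns (negG (H k i) +ᴳ H k j) u v)
          (𝟙≟-cong _≟G_ _≟G_ (v≡u+[-a+b]⇔u-a≡v-b (element ns u) (element ns v) (H k i) (H k j)))
    where i = proj₁ (remQuot {g} g I); j = proj₁ (remQuot {g} g J)
          u = proj₂ (remQuot {g} g I); v = proj₂ (remQuot {g} g J)

  Σ-points : (F : Fin g × Fin g → ℕ) → Σ[< g * g ] (λ Z → F (remQuot g Z)) ≡ Σ[< g ] (λ l → Σ[< g ] (λ w → F (l , w)))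
  Σ-points F = trans (Σ-combine g g _) (Σ-cong g (λ l → Σ-cong g (λ w → cong F (remQuot-combine l w))))

  each-label-once-per-block : ∀ (c a : Elt ns) → Σ[< g ] (λ w → 𝟙 (c ≟G element ns w -ᴳ a)) ≡ 1
  each-label-once-per-block c a = Σ-unique-𝟙 g (λ w → c ≟G element ns w -ᴳ a) (λ w → ≡element-a⇔≡index ns w c a)

  fibre-size : ∀ k c → Σ[< g * g ] (λ Z → 𝟙 (c ≟G label k Z)) ≡ g
  fibre-size zero c = begin
    Σ[< g * g ] (λ Z → 𝟙 (c ≟G label zero Z))        ≡⟨ Σ-points (λ p → 𝟙 (c ≟G label′ zero p)) ⟩
    Σ[< g ] (λ l → Σ[< g ] (λ _ → 𝟙 (c ≟G element ns l))) ≡⟨ Σ-cong g (λ l → Σ-const g _) ⟩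
    Σ[< g ] (λ l → g * 𝟙 (c ≟G element ns l))          ≡⟨ Σ-*ˡ g g _ ⟩
    g * Σ[< g ] (λ l → 𝟙 (c ≟G element ns l))          ≡⟨ cong (g *_) (Σ-unique-𝟙 g (λ l → c ≟G element ns l)
                                                              (λ l → ⇔-trans ≡-sym-⇔ (element≡⇔≡index ns l c))) ⟩
    g * 1                                             ≡⟨ *-identityʳ g ⟩
    g                                                 ∎
    where open ≡-Reasoning
  fibre-size (suc k) c = begin
    Σ[< g * g ] (λ Z → 𝟙 (c ≟G label (suc k) Z))                ≡⟨ Σ-points (λ p → 𝟙 (c ≟G label′ (suc k) p)) ⟩
    Σ[< g ] (λ l → Σ[< g ] (λ w → 𝟙 (c ≟G element ns w -ᴳ H k l))) ≡⟨ Σ-cong g (λ l → each-label-once-per-block c (H k l)) ⟩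
    Σ[< g ] (λ _ → 1)                                            ≡⟨ Σ-const g 1 ⟩
    g * 1                                                        ≡⟨ *-identityʳ g ⟩
    g                                                            ∎
    where open ≡-Reasoning

  meet-zero-suc : ∀ k′ c c′ → meet (label zero) (label (suc k′)) c c′ ≡ 1
  meet-zero-suc k′ c c′ = begin
    meet (label zero) (label (suc k′)) c c′
      ≡⟨ Σ-points (λ p → 𝟙 (c ≟G label′ zero p) * 𝟙 (c′ ≟G label′ (suc k′) p)) ⟩
    Σ[< g ] (λ l → Σ[< g ] (λ w → 𝟙 (c ≟G element ns l) * 𝟙 (c′ ≟G element ns w -ᴳ H k′ l)))
      ≡⟨ Σ-cong g (λ l → Σ-*ˡ g (𝟙 (c ≟G element ns l)) _) ⟩
    Σ[< g ] (λ l → 𝟙 (c ≟G element ns l) * Σ[< g ] (λ w → 𝟙 (c′ ≟G element ns w -ᴳ H k′ l)))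
      ≡⟨ Σ-cong g (λ l → cong (𝟙 (c ≟G element ns l) *_) (each-label-once-per-block c′ (H k′ l))) ⟩
    Σ[< g ] (λ l → 𝟙 (c ≟G element ns l) * 1)
      ≡⟨ Σ-unique g (λ l → c ≟G element ns l) (λ l → ⇔-trans ≡-sym-⇔ (element≡⇔≡index ns l c)) (λ _ → 1) ⟩
    1 ∎
    where open ≡-Reasoning

  module _ (rows : ∀ i k → i ≢ k → ∀ a → Σ[< g ] (λ j → eqG? (H i j -ᴳ H k j) a) ≡ 1) where

    row-difference-unique : ∀ {k k′} → k ≢ k′ → ∀ d → Σ[< g ] (λ l → 𝟙 (H k l -ᴳ H k′ l ≟G d)) ≡ 1
    row-difference-unique {k} {k′} k≢k′ d =
      trans (Σ-cong g (λ l → sym (eqG?-𝟙 (H k l -ᴳ H k′ l) d))) (rows k k′ k≢k′ d)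

    column-difference-injective : ∀ {i j} → i ≢ j → Injective _≡_ _≡_ (λ k → H k j -ᴳ H k i)
    column-difference-injective {i} {j} i≢j {k} {k′} e with k ≟F k′
    ... | yes k≡k′ = k≡k′
    ... | no k≢k′  = ⊥-elim (2≰1 (subst₂ _≤_ (cong₂ _+_ at-i at-j) (row-difference-unique k≢k′ d) (Σ-two g F i≢j)))
      where
      d = H k i -ᴳ H k′ i
      F : Fin g → ℕ
      F l = 𝟙 (H k l -ᴳ H k′ l ≟G d)
      at-i : F i ≡ 1
      at-i = 𝟙-yes refl (d ≟G d)
      at-j : F j ≡ 1
      at-j = 𝟙-yes (Equivalence.to (b-a≡b′-a′⇔b-b′≡a-a′ (H k j) (H k i) (H k′ j) (H k′ i)) e) (H k j -ᴳ H k′ j ≟G d)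
      2≰1 : ¬ 2 ≤ 1
      2≰1 (s≤s ())

    column-difference-unique : ∀ {i j} → i ≢ j → ∀ d → Σ[< g ] (λ k → 𝟙 (H k j -ᴳ H k i ≟G d)) ≡ 1
    column-difference-unique {i} {j} i≢j d =
      Σ-unique-𝟙 g (λ k → f k ≟G d) (λ k → mk⇔ (λ e → f-inj (trans e (sym fk₀≡d))) (λ e → trans (cong f e) fk₀≡d))
      where
      f : Fin g → Elt ns
      f k = H k j -ᴳ H k i
      f-inj : Injective _≡_ _≡_ f
      f-inj = column-difference-injective i≢j
      hit : ∃ λ k₀ → index ns (f k₀) ≡ index ns d
      hit = injective⇒surjective (f-inj ∘ index-injective ns) (index ns d)
      fk₀≡d : f (proj₁ hit) ≡ d
      fk₀≡d = index-injective ns (proj₂ hit)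

    concurrence : ∀ i u j v (i≟j : Dec (i ≡ j)) →
      𝟙 i≟j + Σ[< g ] (λ k → 𝟙 (element ns u -ᴳ H k i ≟G element ns v -ᴳ H k j)) ≡ g * (𝟙 i≟j * 𝟙 (u ≟F v)) + 1
    concurrence i u .i v (yes refl) = begin
      1 + Σ[< g ] (λ k → 𝟙 (element ns u -ᴳ H k i ≟G element ns v -ᴳ H k i))
        ≡⟨ cong (1 +_) (Σ-cong g (λ k → 𝟙≟-cong _≟G_ _≟F_
             (⇔-trans (x-a≡y-a⇔x≡y (element ns u) (element ns v) (H k i)) (⇔-sym (≡⇔element≡element ns u v))))) ⟩
      1 + Σ[< g ] (λ _ → 𝟙 (u ≟F v))   ≡⟨ cong (1 +_) (Σ-const g _) ⟩
      1 + g * 𝟙 (u ≟F v)               ≡⟨ +-comm 1 _ ⟩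
      g * 𝟙 (u ≟F v) + 1               ≡⟨ cong (λ z → g * z + 1) (*-identityˡ _) ⟨
      g * (1 * 𝟙 (u ≟F v)) + 1         ∎
      where open ≡-Reasoning
    concurrence i u j v (no i≢j) = begin
      Σ[< g ] (λ k → 𝟙 (element ns u -ᴳ H k i ≟G element ns v -ᴳ H k j))
        ≡⟨ Σ-cong g (λ k → 𝟙≟-cong _≟G_ _≟G_ (u-a≡v-b⇔b-a≡v-u (element ns u) (H k i) (element ns v) (H k j))) ⟩
      Σ[< g ] (λ k → 𝟙 (H k j -ᴳ H k i ≟G element ns v -ᴳ element ns u))
        ≡⟨ column-difference-unique i≢j _ ⟩
      1                                ≡⟨ cong (_+ 1) (*-zeroʳ g) ⟨
      g * (0 * 𝟙 (u ≟F v)) + 1         ∎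
      where open ≡-Reasoning

    Σ-agreeing-labels : ∀ I J → Σ[< suc g ] (λ k → 𝟙 (label k I ≟G label k J)) ≡ g * δ I J + 1
    Σ-agreeing-labels I J = begin
      𝟙 (element ns i ≟G element ns j) + S   ≡⟨ cong (_+ S) (𝟙≟-cong _≟G_ _≟F_ (⇔-sym (≡⇔element≡element ns i j))) ⟩
      𝟙 (i ≟F j) + S                         ≡⟨ concurrence i u j v (i ≟F j) ⟩
      g * (𝟙 (i ≟F j) * 𝟙 (u ≟F v)) + 1     ≡⟨ cong (λ z → g * z + 1) δ-blocks ⟨
      g * δ I J + 1                          ∎
      where
      open ≡-Reasoning
      i = proj₁ (remQuot {g} g I); j = proj₁ (remQuot {g} g J)
      u = proj₂ (remQuot {g} g I); v = proj₂ (remQuot {g} g J)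
      S = Σ[< g ] (λ k → 𝟙 (element ns u -ᴳ H k i ≟G element ns v -ᴳ H k j))
      δ-blocks : δ I J ≡ 𝟙 (i ≟F j) * 𝟙 (u ≟F v)
      δ-blocks = trans (δ-𝟙 I J) (trans (𝟙-cong (⇔-trans (≡⇔remQuot≡remQuot g I J) (mk⇔ ,-injective (uncurry (cong₂ _,_))))
                                              (I ≟F J) (i ≟F j ×-dec u ≟F v))
                                        (𝟙-×-dec (i ≟F j) (u ≟F v)))

    fibres-meet-once : ∀ {k k′} → k ≢ k′ → ∀ c c′ → meet (label k) (label k′) c c′ ≡ 1
    fibres-meet-once {zero}  {zero}   k≢k′ c c′ = ⊥-elim (k≢k′ refl)
    fibres-meet-once {zero}  {suc k′} k≢k′ c c′ = meet-zero-suc k′ c c′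
    fibres-meet-once {suc k} {zero}   k≢k′ c c′ = trans (meet-comm (label (suc k)) (label zero) c c′) (meet-zero-suc k c′ c)
    fibres-meet-once {suc k} {suc k′} k≢k′ c c′ = begin
      meet (label (suc k)) (label (suc k′)) c c′
        ≡⟨ Σ-points (λ p → 𝟙 (c ≟G label′ (suc k) p) * 𝟙 (c′ ≟G label′ (suc k′) p)) ⟩
      Σ[< g ] (λ l → Σ[< g ] (λ w → 𝟙 (c ≟G element ns w -ᴳ H k l) * 𝟙 (c′ ≟G element ns w -ᴳ H k′ l)))
        ≡⟨ Σ-cong g (λ l → Σ-unique g (λ w → c ≟G element ns w -ᴳ H k l) (λ w → ≡element-a⇔≡index ns w c (H k l)) _) ⟩
      Σ[< g ] (λ l → 𝟙 (c′ ≟G element ns (index ns (c +ᴳ H k l)) -ᴳ H k′ l))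
        ≡⟨ Σ-cong g (λ l → cong (λ x → 𝟙 (c′ ≟G x -ᴳ H k′ l)) (element-index ns (c +ᴳ H k l))) ⟩
      Σ[< g ] (λ l → 𝟙 (c′ ≟G c +ᴳ H k l -ᴳ H k′ l))
        ≡⟨ Σ-cong g (λ l → 𝟙≟-cong _≟G_ _≟G_ (c′≡c+a-b⇔a-b≡c′-c c c′ (H k l) (H k′ l))) ⟩
      Σ[< g ] (λ l → 𝟙 (H k l -ᴳ H k′ l ≟G c′ -ᴳ c))
        ≡⟨ row-difference-unique (k≢k′ ∘ cong suc) (c′ -ᴳ c) ⟩
      1 ∎
      where open ≡-Reasoning

lemma5p8 : (ns : List ℕ) → (H : Fin (order ns) → Fin (order ns) → Elt ns) →
    IsGH ns 1 H →
    (ΣM (suc (order ns)) (Cmat ns H)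
       ≈M ((order ns ⊛ Id (order ns * order ns)) ⊕M Jm (order ns * order ns)))
    × (∀ k → (Cmat ns H k · (Cmat ns H k ᵀ)) ≈M (order ns ⊛ Cmat ns H k))
    × (∀ k k' → k ≢ k' → (Cmat ns H k · (Cmat ns H k' ᵀ)) ≈M Jm (order ns * order ns))
lemma5p8 ns H (_ , rows) =
    (λ I J → trans (Σ-cong (suc g) (λ k → Cmat-label k I J)) (Σ-agreeing-labels rows I J))
  , (λ k → ·ᵀ-self (Cmat-label k) (fibre-size k))
  , (λ k k′ k≢k′ → ·ᵀ-transversal (Cmat-label k) (Cmat-label k′) (fibres-meet-once rows k≢k′))
  where
  open Net ns H
  open SameLabel (_≟G_ {ns})
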